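{- For all natural numbers $k\geq 0$ and $n\geq 0$ and every term $t$, the clause $\vdash s(x_{k+1})\leq m(k,x,\max(s(x_{k+1}),t))$ is derivable by resolution from $C(n)$.
   Context: Work in a first-order language with a constant $0$, unary function symbols $s$ and $f$, a binary function symbol $\max$, a binary predicate symbol $\leq$, and atoms of the form $f(t)=k$ where $t$ is a term and $k$ is a numeral; here $=$ is an uninterpreted binary predicate (no equality axioms). A clause is a sequent $\Pi \vdash \Delta$ of finite multisets of atoms; its variables are implicitly universally quantified. For $n\ge 0$, $C(n)$ consists of, with variables $\alpha,\beta,\gamma$: (C1) $\vdash \alpha \leq \alpha$; (C2) $\max(\alpha,\beta)\leq\gamma \vdash \alpha\leq\gamma$; (C3) $\max(\alpha,\beta)\leq\gamma \vdash \beta\leq\gamma$; (C4$(k)$) $f(\beta)=k,\ f(\alpha)=k,\ s(\beta)\leq\alpha \vdash$ for each $0\le k\le n$; (C5) $\vdash f(\alpha)=0,\ldots, f(\alpha)=n$. A clause is derivable by resolution from $C(n)$ if it is obtained in finitely many steps from variable-renamed copies of clauses of $C(n)$ by the resolution rule (from $\Pi\vdash P,\Delta$ and $\Pi',P'\vdash\Delta'$ and a substitution $\sigma$ with $P\sigma=P'\sigma$, infer $\Pi\sigma,\Pi'\sigma\vdash\Delta\sigma,\Delta'\sigma$) and contraction (merging identical atoms on one side). Let $x_1,x_2,\ldots$ be variables. The term $m(k,x,t)$ is defined by $m(0,x,t)=t$ and $m(k+1,x,t)=m(k,x,\max(s(x_{k+1}),t))$; explicitly $m(k,x,t)=\max(s(x_1),\max(s(x_2),\ldots,\max(s(x_k),t)\ldots))$.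 -}

module Defs where

open import Data.Nat using (ℕ; zero; suc; _≤_)
open import Data.List using (List; []; _∷_; _++_; map; upTo)
open import Data.List.Relation.Binary.Permutation.Propositional using (_↭_)
open import Relation.Binary.PropositionalEquality using (_≡_)
open import Function.Definitions using (Injective)

Var : Set
Var = ℕ

data Term : Set where
  var  : Var → Term
  zer  : Term
  s    : Term → Term
  f    : Term → Term
  max  : Term → Term → Term

data Atom : Set where
  _≤ₐ_  : Term → Term → Atom
  f[_]≐_ : Term → ℕ → Atom

-- Clauses  Π ⊢ Δ  (multisets represented by lists; the derivability
-- relation below is closed under permutation of either side).
record Clause : Set where
  constructor _⊢_
  field
    ante : List Atom
    succ : List Atom

Subst : Set
Subst = Var → Term

_[_]ₜ : Term → Subst → Term
var x     [ σ ]ₜ = σ x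
zer       [ σ ]ₜ = zer
s t       [ σ ]ₜ = s (t [ σ ]ₜ)
f t       [ σ ]ₜ = f (t [ σ ]ₜ)
max t u   [ σ ]ₜ = max (t [ σ ]ₜ) (u [ σ ]ₜ)

_[_]ₐ : Atom → Subst → Atom
(t ≤ₐ u)    [ σ ]ₐ = (t [ σ ]ₜ) ≤ₐ (u [ σ ]ₜ)
(f[ t ]≐ k) [ σ ]ₐ = f[ t [ σ ]ₜ ]≐ k

_[_]ₗ : List Atom → Subst → List Atom
as [ σ ]ₗ = map (_[ σ ]ₐ) as

_[_]c : Clause → Subst → Clause
(Π ⊢ Δ) [ σ ]c = (Π [ σ ]ₗ) ⊢ (Δ [ σ ]ₗ)

α β γ : Term
α = var 0
β = var 1
γ = var 2

data InC (n : ℕ) : Clause → Set where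
  C1 : InC n ([] ⊢ ((α ≤ₐ α) ∷ []))
  C2 : InC n ((max α β ≤ₐ γ ∷ []) ⊢ ((α ≤ₐ γ) ∷ []))
  C3 : InC n ((max α β ≤ₐ γ ∷ []) ⊢ ((β ≤ₐ γ) ∷ []))
  C4 : (k : ℕ) → k ≤ n →
       InC n ((f[ β ]≐ k ∷ f[ α ]≐ k ∷ (s β ≤ₐ α) ∷ []) ⊢ [])
  C5 : InC n ([] ⊢ map (λ k → f[ α ]≐ k) (upTo (suc n)))

data Derivable (n : ℕ) : Clause → Set where
  input   : ∀ {c} → InC n c → (ρ : Var → Var) → Injective _≡_ _≡_ ρ →
            Derivable n (c [ (λ x → var (ρ x)) ]c)
  perm    : ∀ {Π Π′ Δ Δ′} → Derivable n (Π ⊢ Δ) → Π ↭ Π′ → Δ ↭ Δ′ →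
            Derivable n (Π′ ⊢ Δ′)
  resolve : ∀ {Π Δ Π′ Δ′ P P′} →
            Derivable n (Π ⊢ (P ∷ Δ)) → Derivable n ((P′ ∷ Π′) ⊢ Δ′) →
            (σ : Subst) → P [ σ ]ₐ ≡ P′ [ σ ]ₐ →
            Derivable n (((Π [ σ ]ₗ) ++ (Π′ [ σ ]ₗ)) ⊢ ((Δ [ σ ]ₗ) ++ (Δ′ [ σ ]ₗ)))
  contrL  : ∀ {A Π Δ} → Derivable n ((A ∷ A ∷ Π) ⊢ Δ) → Derivable n ((A ∷ Π) ⊢ Δ)
  contrR  : ∀ {A Π Δ} → Derivable n (Π ⊢ (A ∷ A ∷ Δ)) → Derivable n (Π ⊢ (A ∷ Δ))

x : ℕ → Term
x i = var i

m : ℕ → Term → Term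
m zero    t = t
m (suc k) t = m k (max (s (x (suc k))) t)

-- Derivability by resolution is closed under injective renaming, so a derived
-- unit clause can always be moved apart from the variables of C2 and C3.
-- Resolving it against them then shows: whenever ⊢ max a b ≤ w is derivable,
-- so are ⊢ a ≤ w and ⊢ b ≤ w; and instantiating C1 to ⊢ max a b ≤ max a b
-- inside such a step gives ⊢ a ≤ max a b and ⊢ b ≤ max a b. Hence ⊢ u ≤ w is
-- derivable for every u lying strictly below w on the max-tree of w, and
-- s(x_{k+1}) lies below m(k,x,max(s(x_{k+1}),t)) in this sense.
module Submission where

open import Defs
open import Data.Nat using (ℕ; suc; zero; _+_)
open import Data.List using ([]; _∷_; _++_)
open import Data.List.Properties using (map-++; map-∘; map-cong)
open import Data.List.Relation.Binary.Permutation.Propositional.Properties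
  using (map⁺)
open import Function.Definitions using (Injective)
open import Relation.Binary.Construct.Closure.Transitive
  using (TransClosure; [_]; _∷_; _∷ʳ_)
open import Relation.Binary.PropositionalEquality
  using (_≡_; refl; sym; trans; cong; cong₂; subst; module ≡-Reasoning)

_⨾_ : Subst → Subst → Subst
(σ ⨾ τ) v = σ v [ τ ]ₜ

[]ₜ-⨾ : ∀ (σ τ : Subst) t → t [ σ ]ₜ [ τ ]ₜ ≡ t [ σ ⨾ τ ]ₜ
[]ₜ-⨾ σ τ (var v)   = refl
[]ₜ-⨾ σ τ zer       = refl
[]ₜ-⨾ σ τ (s t)     = cong s ([]ₜ-⨾ σ τ t)
[]ₜ-⨾ σ τ (f t)     = cong f ([]ₜ-⨾ σ τ t)
[]ₜ-⨾ σ τ (max t u) = cong₂ max ([]ₜ-⨾ σ τ t) ([]ₜ-⨾ σ τ u)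

[]ₐ-⨾ : ∀ (σ τ : Subst) A → A [ σ ]ₐ [ τ ]ₐ ≡ A [ σ ⨾ τ ]ₐ
[]ₐ-⨾ σ τ (t ≤ₐ u)    = cong₂ _≤ₐ_ ([]ₜ-⨾ σ τ t) ([]ₜ-⨾ σ τ u)
[]ₐ-⨾ σ τ (f[ t ]≐ k) = cong (f[_]≐ k) ([]ₜ-⨾ σ τ t)

[]ₗ-⨾ : ∀ (σ τ : Subst) Γ → Γ [ σ ]ₗ [ τ ]ₗ ≡ Γ [ σ ⨾ τ ]ₗ
[]ₗ-⨾ σ τ Γ = trans (sym (map-∘ Γ)) (map-cong ([]ₐ-⨾ σ τ) Γ)

[]c-⨾ : ∀ (σ τ : Subst) c → c [ σ ]c [ τ ]c ≡ c [ σ ⨾ τ ]c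
[]c-⨾ σ τ (Π ⊢ Δ) = cong₂ _⊢_ ([]ₗ-⨾ σ τ Π) ([]ₗ-⨾ σ τ Δ)

[]ₗ-++-⨾ : ∀ (σ τ : Subst) Γ Δ →
  Γ [ σ ⨾ τ ]ₗ ++ Δ [ σ ⨾ τ ]ₗ ≡ (Γ [ σ ]ₗ ++ Δ [ σ ]ₗ) [ τ ]ₗ
[]ₗ-++-⨾ σ τ Γ Δ = begin
  Γ [ σ ⨾ τ ]ₗ ++ Δ [ σ ⨾ τ ]ₗ      ≡⟨ sym (cong₂ _++_ ([]ₗ-⨾ σ τ Γ) ([]ₗ-⨾ σ τ Δ)) ⟩
  Γ [ σ ]ₗ [ τ ]ₗ ++ Δ [ σ ]ₗ [ τ ]ₗ ≡⟨ sym (map-++ (_[ τ ]ₐ) (Γ [ σ ]ₗ) (Δ [ σ ]ₗ)) ⟩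
  (Γ [ σ ]ₗ ++ Δ [ σ ]ₗ) [ τ ]ₗ      ∎
  where open ≡-Reasoning

[]ₜ-id : ∀ t → t [ var ]ₜ ≡ t
[]ₜ-id (var v)   = refl
[]ₜ-id zer       = refl
[]ₜ-id (s t)     = cong s ([]ₜ-id t)
[]ₜ-id (f t)     = cong f ([]ₜ-id t)
[]ₜ-id (max t u) = cong₂ max ([]ₜ-id t) ([]ₜ-id u)

[]ₐ-id : ∀ A → A [ var ]ₐ ≡ A
[]ₐ-id (t ≤ₐ u)    = cong₂ _≤ₐ_ ([]ₜ-id t) ([]ₜ-id u)
[]ₐ-id (f[ t ]≐ k) = cong (f[_]≐ k) ([]ₜ-id t)

Derivable-rename : ∀ {n c} {ρ : Var → Var} → Injective _≡_ _≡_ ρ →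
  Derivable n c → Derivable n (c [ (λ v → var (ρ v)) ]c)
Derivable-rename {n} {ρ = ρ} ρ-inj (input {c} c∈C ρ′ ρ′-inj) =
  subst (Derivable n) (sym ([]c-⨾ (λ v → var (ρ′ v)) (λ v → var (ρ v)) c))
    (input c∈C (λ v → ρ (ρ′ v)) (λ e → ρ′-inj (ρ-inj e)))
Derivable-rename ρ-inj (perm d Π↭Π′ Δ↭Δ′) =
  perm (Derivable-rename ρ-inj d) (map⁺ _ Π↭Π′) (map⁺ _ Δ↭Δ′)
Derivable-rename {n} {ρ = ρ} ρ-inj
    (resolve {Π} {Δ} {Π′} {Δ′} {P} {P′} d d′ σ P≐P′) =
  subst (Derivable n)
    (cong₂ _⊢_ ([]ₗ-++-⨾ σ τ Π Π′) ([]ₗ-++-⨾ σ τ Δ Δ′))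
    (resolve d d′ (σ ⨾ τ) (begin
      P [ σ ⨾ τ ]ₐ       ≡⟨ sym ([]ₐ-⨾ σ τ P) ⟩
      P [ σ ]ₐ [ τ ]ₐ    ≡⟨ cong (_[ τ ]ₐ) P≐P′ ⟩
      P′ [ σ ]ₐ [ τ ]ₐ   ≡⟨ []ₐ-⨾ σ τ P′ ⟩
      P′ [ σ ⨾ τ ]ₐ      ∎))
  where
    open ≡-Reasoning
    τ : Subst
    τ v = var (ρ v)
Derivable-rename ρ-inj (contrL d) = contrL (Derivable-rename ρ-inj d)
Derivable-rename ρ-inj (contrR d) = contrR (Derivable-rename ρ-inj d)

data _⊏₁_ : Term → Term → Set where
  argˡ : ∀ {a b} → a ⊏₁ max a b
  argʳ : ∀ {a b} → b ⊏₁ max a b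

_⊏_ : Term → Term → Set
_⊏_ = TransClosure _⊏₁_

_∷ₛ_ : Term → Subst → Subst
(t ∷ₛ τ) zero    = t
(t ∷ₛ τ) (suc v) = τ v

shift₃-inj : Injective _≡_ _≡_ (3 +_)
shift₃-inj refl = refl

-- C2 and C3 are used with their own variables 0, 1, 2, and the unit clause is
-- renamed past them, so that one substitution a ∷ₛ b ∷ₛ w ∷ₛ τ serves both.
resolve-⊏₁ : ∀ {n P u v w} → u ⊏₁ v → Derivable n ([] ⊢ (P ∷ [])) →
  (τ : Subst) → P [ τ ]ₐ ≡ (v ≤ₐ w) → Derivable n ([] ⊢ ((u ≤ₐ w) ∷ []))
resolve-⊏₁ {P = P} {w = w} (argˡ {a} {b}) d τ P[τ]≡ =
  resolve (Derivable-rename shift₃-inj d) (input C2 (λ v → v) (λ e → e))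
    (a ∷ₛ (b ∷ₛ (w ∷ₛ τ))) (trans ([]ₐ-⨾ _ _ P) P[τ]≡)
resolve-⊏₁ {P = P} {w = w} (argʳ {a} {b}) d τ P[τ]≡ =
  resolve (Derivable-rename shift₃-inj d) (input C3 (λ v → v) (λ e → e))
    (a ∷ₛ (b ∷ₛ (w ∷ₛ τ))) (trans ([]ₐ-⨾ _ _ P) P[τ]≡)

Derivable-⊏ : ∀ {n u w} → u ⊏ w → Derivable n ([] ⊢ ((u ≤ₐ w) ∷ []))
Derivable-⊏ {w = w} [ u⊏₁w ] =
  resolve-⊏₁ u⊏₁w (input C1 (λ v → v) (λ e → e)) (λ _ → w) refl
Derivable-⊏ (u⊏₁v ∷ v⊏w) =
  resolve-⊏₁ u⊏₁v (Derivable-⊏ v⊏w) var ([]ₐ-id _)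

⊏-m : ∀ k {u T} → u ⊏ T → u ⊏ m k T
⊏-m zero    u⊏T = u⊏T
⊏-m (suc k) u⊏T = ⊏-m k (u⊏T ∷ʳ argʳ)

corollary1 : (k n : ℕ) (t : Term) →
    Derivable n ([] ⊢ ((s (x (suc k)) ≤ₐ m k (max (s (x (suc k))) t)) ∷ []))
corollary1 k n t = Derivable-⊏ (⊏-m k [ argˡ ])
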